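{- Let $n$ and $k$ be positive integers with $n \ge k \ge 2$. If $G \in \varGamma(n;k)$, then for every vertex $u_1$ of $G$, $G$ has an induced path on at least $k+1$ vertices having $u_1$ as an endpoint.
   Context: All graphs are simple, finite and undirected. The circumference $c(G)$ of a graph $G$ is the number of vertices in a longest cycle of $G$. A graph is Hamiltonian if it contains a cycle through all of its vertices. For positive integers $n$ and $k$ with $n \ge k$, $\varGamma(n;k)$ denotes the set of all graphs $G$ of order $n$ such that $c(G)=n-k$ and every induced subgraph of $G$ with $n-k$ vertices is Hamiltonian. -}

module Defs where

open import Data.Nat using (ℕ; zero; suc; _≤_; _<_)
open import Data.Fin using (Fin; toℕ)
open import Data.Fin.Subset using (Subset; _∈_; ∣_∣)
open import Data.Bool using (Bool; true; false)
open import Data.Product using (Σ; _×_; ∃; ∃-syntax)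
open import Data.Sum using (_⊎_)
open import Relation.Binary.PropositionalEquality using (_≡_)
open import Relation.Nullary using (¬_)
open import Function.Definitions using (Injective)

record Graph (n : ℕ) : Set where
  field
    adj   : Fin n → Fin n → Bool
    sym   : ∀ u v → adj u v ≡ adj v u
    irrefl : ∀ v → adj v v ≡ false

open Graph public

Adj : ∀ {n} → Graph n → Fin n → Fin n → Set
Adj G u v = adj G u v ≡ true

CycSucc : ∀ {m} → Fin m → Fin m → Set
CycSucc {m} i j = (toℕ j ≡ suc (toℕ i)) ⊎ ((toℕ j ≡ 0) × (suc (toℕ i) ≡ m))

record Cycle {n} (G : Graph n) (m : ℕ) : Set where
  field
    atLeast3 : 3 ≤ m
    vert     : Fin m → Fin n
    distinct : Injective _≡_ _≡_ vert
    edges    : ∀ i j → CycSucc i j → Adj G (vert i) (vert j)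

open Cycle public

Circumference : ∀ {n} → Graph n → ℕ → Set
Circumference G m =
  (∀ l → Cycle G l → l ≤ m) ×
  (Σ (Cycle G m) (λ _ → 3 ≤ m) ⊎ ((m ≡ 0) × (∀ l → ¬ Cycle G l)))

-- The induced subgraph G[S] is Hamiltonian: there is a cycle of G with
-- exactly ∣ S ∣ vertices all lying in S (i.e. a spanning cycle of G[S]).
InducedHamiltonian : ∀ {n} → Graph n → Subset n → Set
InducedHamiltonian G S = Σ (Cycle G ∣ S ∣) (λ C → ∀ i → vert C i ∈ S)

InΓ : (n k : ℕ) → Graph n → Set
InΓ n k G = Σ ℕ (λ c → (c Data.Nat.+ k ≡ n) × Circumference G c ×
              (∀ (S : Subset n) → ∣ S ∣ ≡ c → InducedHamiltonian G S))

record InducedPath {n} (G : Graph n) (m : ℕ) : Set where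
  field
    pvert     : Fin m → Fin n
    pdistinct : Injective _≡_ _≡_ pvert
    padj      : ∀ i j → Adj G (pvert i) (pvert j) → (toℕ j ≡ suc (toℕ i)) ⊎ (toℕ i ≡ suc (toℕ j))
    pedge     : ∀ i j → toℕ j ≡ suc (toℕ i) → Adj G (pvert i) (pvert j)

open InducedPath public

{-# OPTIONS --safe #-}

-- Grow an induced path f 0 = u₁, f 1, …, f j one vertex at a time.  While j < k, at least
-- n − j > c vertices avoid f 0, …, f (j − 1), so c of them including f j induce a
-- Hamiltonian cycle, which meets the path only in f j.  The predecessor x of f j on that
-- cycle is a new neighbour of f j, and no other f a is adjacent to x: otherwise
-- f a, …, f (j − 1) followed by the cycle from f j round to x would be longer than c(G) = c.

module Submission where

open import Defs
open import Data.Nat using (ℕ; zero; suc; pred; _+_; _≤_; _<_; z≤n; s≤s; z<s; NonZero; >-nonZero; >-nonZero⁻¹)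
open import Data.Nat.Properties
open import Data.Nat.DivMod using (_mod_; m<n⇒m%n≡m)
open import Data.Fin using (Fin; zero; suc; toℕ)
open import Data.Fin.Properties using (toℕ<n; toℕ-injective; toℕ-fromℕ<)
import Data.Fin.Properties as Finₚ
open import Data.Fin.Subset using (Subset; _∈_; _∉_; _⊆_; ∣_∣; ⊤; ⊥; ⁅_⁆; _-_; inside; outside)
open import Data.Fin.Subset.Properties
  using (∈⊤; ∣⊤∣≡n; ∣⊥∣≡0; ⊥⊆; s⊆s; x∈⁅x⁆; x∈⁅y⁆⇒x≡y; ∣⁅x⁆∣≡1; p─⊥≡p; p─q⊆p; x∈p∧x≢y⇒x∈p-y; x∈p⇒∣p-x∣<∣p∣)
open import Data.Vec using (_∷_; here; there)
open import Data.Product using (Σ; _×_; _,_; proj₁; ∃-syntax)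
open import Data.Sum using (_⊎_; inj₁; inj₂)
open import Data.Empty using (⊥-elim)
open import Function using (_∘_; const)
open import Function.Definitions using (Injective)
open import Relation.Nullary using (¬_; yes; no)
open import Relation.Nullary.Negation using (contradiction)
open import Relation.Binary.PropositionalEquality
  using (_≡_; _≢_; refl; cong; subst; subst₂) renaming (sym to ≡-sym; trans to ≡-trans)

∣p∣≤1+∣p-x∣ : ∀ {m} (p : Subset m) x → ∣ p ∣ ≤ suc ∣ p - x ∣
∣p∣≤1+∣p-x∣ (outside ∷ p) zero    = subst (λ q → ∣ p ∣ ≤ suc ∣ q ∣) (≡-sym (p─⊥≡p p)) (n≤1+n _)
∣p∣≤1+∣p-x∣ (inside  ∷ p) zero    = subst (λ q → suc ∣ p ∣ ≤ suc ∣ q ∣) (≡-sym (p─⊥≡p p)) ≤-refl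
∣p∣≤1+∣p-x∣ (outside ∷ p) (suc x) = ∣p∣≤1+∣p-x∣ p x
∣p∣≤1+∣p-x∣ (inside  ∷ p) (suc x) = s≤s (∣p∣≤1+∣p-x∣ p x)

x∉p-x : ∀ {m} (p : Subset m) x → x ∉ p - x
x∉p-x (_ ∷ p) (suc x) (there x∈p-x) = x∉p-x p x x∈p-x

subset-of-size : ∀ {m k} (p : Subset m) → k ≤ ∣ p ∣ → ∃[ q ] q ⊆ p × ∣ q ∣ ≡ k
subset-of-size {m} {zero} p _ = ⊥ , ⊥⊆ , ∣⊥∣≡0 m
subset-of-size {k = suc k} (outside ∷ p) k<∣p∣ with subset-of-size p k<∣p∣
... | q , q⊆p , ∣q∣≡k = outside ∷ q , s⊆s q⊆p , ∣q∣≡k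
subset-of-size {k = suc k} (inside ∷ p) (s≤s k≤∣p∣) with subset-of-size p k≤∣p∣
... | q , q⊆p , ∣q∣≡k = inside ∷ q , s⊆s q⊆p , cong suc ∣q∣≡k

subset-of-size-∋ : ∀ {m k} (p : Subset m) {x} → x ∈ p → 0 < k → k ≤ ∣ p ∣ →
                   ∃[ q ] q ⊆ p × x ∈ q × ∣ q ∣ ≡ k
subset-of-size-∋ {k = zero} _ _ () _
subset-of-size-∋ {k = suc zero} p {x} x∈p _ _ =
  ⁅ x ⁆ , (λ y∈⁅x⁆ → subst (_∈ p) (≡-sym (x∈⁅y⁆⇒x≡y x y∈⁅x⁆)) x∈p) , x∈⁅x⁆ x , ∣⁅x⁆∣≡1 x
subset-of-size-∋ {k = suc (suc k)} (inside ∷ p) here _ (s≤s k<∣p∣) with subset-of-size p k<∣p∣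
... | q , q⊆p , ∣q∣≡k = inside ∷ q , s⊆s q⊆p , here , cong suc ∣q∣≡k
subset-of-size-∋ {k = suc (suc k)} (outside ∷ p) (there x∈p) _ k<∣p∣
  with subset-of-size-∋ p x∈p z<s k<∣p∣
... | q , q⊆p , x∈q , ∣q∣≡k = outside ∷ q , s⊆s q⊆p , there x∈q , ∣q∣≡k
subset-of-size-∋ {k = suc (suc k)} (inside ∷ p) (there x∈p) _ (s≤s k<∣p∣)
  with subset-of-size-∋ p x∈p z<s k<∣p∣
... | q , q⊆p , x∈q , ∣q∣≡k = inside ∷ q , s⊆s q⊆p , there x∈q , cong suc ∣q∣≡k

injective⇒≤∣p∣ : ∀ {k m} (p : Subset m) {g : Fin k → Fin m} →
                 Injective _≡_ _≡_ g → (∀ i → g i ∈ p) → k ≤ ∣ p ∣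
injective⇒≤∣p∣ {zero}  p         _     _    = z≤n
injective⇒≤∣p∣ {suc k} p {g} g-inj g∈p = ≤-trans (s≤s rest) (x∈p⇒∣p-x∣<∣p∣ (g∈p zero))
  where
  rest : k ≤ ∣ p - g zero ∣
  rest = injective⇒≤∣p∣ (p - g zero) (Finₚ.suc-injective ∘ g-inj)
           (λ i → x∈p∧x≢y⇒x∈p-y (g∈p (suc i)) (Finₚ.0≢1+n ∘ g-inj ∘ ≡-sym))

injective⇒onto : ∀ {k m} (p : Subset m) {g : Fin k → Fin m} →
                 Injective _≡_ _≡_ g → (∀ i → g i ∈ p) → ∣ p ∣ ≡ k → ∀ {x} → x ∈ p → ∃[ i ] g i ≡ x
injective⇒onto p {g} g-inj g∈p ∣p∣≡k {x} x∈p with Finₚ.any? (λ i → g i Finₚ.≟ x)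
... | yes hit = hit
... | no ¬hit = contradiction (subst (∣ p - x ∣ <_) ∣p∣≡k (x∈p⇒∣p-x∣<∣p∣ x∈p))
                  (≤⇒≯ (injective⇒≤∣p∣ (p - x) g-inj (λ i → x∈p∧x≢y⇒x∈p-y (g∈p i) (¬hit ∘ (i ,_)))))

unvisited : ∀ {n} → (ℕ → Fin n) → ℕ → Subset n
unvisited f zero    = ⊤
unvisited f (suc s) = unvisited f s - f s

∣unvisited∣ : ∀ {n} (f : ℕ → Fin n) s → n ≤ s + ∣ unvisited f s ∣
∣unvisited∣ {n} f zero = ≤-reflexive (≡-sym (∣⊤∣≡n n))
∣unvisited∣ f (suc s) = ≤-trans (∣unvisited∣ f s)
  (≤-trans (+-monoʳ-≤ s (∣p∣≤1+∣p-x∣ (unvisited f s) (f s))) (≤-reflexive (+-suc s _)))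

visited∉unvisited : ∀ {n} (f : ℕ → Fin n) {s a} → a < s → f a ∉ unvisited f s
visited∉unvisited f {suc s} a<1+s fa∈ with m≤n⇒m<n∨m≡n (≤-pred a<1+s)
... | inj₁ a<s  = visited∉unvisited f a<s (p─q⊆p _ _ fa∈)
... | inj₂ refl = x∉p-x (unvisited f s) (f s) fa∈

∈unvisited : ∀ {n} (f : ℕ → Fin n) s {y} → (∀ {a} → a < s → y ≢ f a) → y ∈ unvisited f s
∈unvisited f zero    _    = ∈⊤
∈unvisited f (suc s) y≢fa =
  x∈p∧x≢y⇒x∈p-y (∈unvisited f s (y≢fa ∘ m<n⇒m<1+n)) (y≢fa ≤-refl)

_++[_]_ : ∀ {a} {A : Set a} → (ℕ → A) → ℕ → (ℕ → A) → ℕ → A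
(d ++[ zero  ] e) t       = e t
(d ++[ suc l ] e) zero    = d zero
(d ++[ suc l ] e) (suc t) = ((d ∘ suc) ++[ l ] e) t

module _ {a} {A : Set a} where

  ++-left : ∀ {l t} (d e : ℕ → A) → t < l → (d ++[ l ] e) t ≡ d t
  ++-left {suc l} {zero}  d e _         = refl
  ++-left {suc l} {suc t} d e (s≤s t<l) = ++-left (d ∘ suc) e t<l

  ++-right : ∀ l (d e : ℕ → A) t → (d ++[ l ] e) (l + t) ≡ e t
  ++-right zero    d e t = refl
  ++-right (suc l) d e t = ++-right l (d ∘ suc) e t

data Split (l : ℕ) : ℕ → Set where
  left  : ∀ {t} → t < l → Split l t
  right : ∀ s → Split l (l + s)

split : ∀ l t → Split l t
split zero    t       = right t
split (suc l) zero    = left z<s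
split (suc l) (suc t) with split l t
... | left t<l = left (s≤s t<l)
... | right s  = right s

toℕ-mod : ∀ {m t} .{{_ : NonZero m}} → t < m → toℕ (t mod m) ≡ t
toℕ-mod t<m = ≡-trans (toℕ-fromℕ< _) (m<n⇒m%n≡m t<m)

module _ {n} (G : Graph n) where

  adj-sym : ∀ {u v} → Adj G u v → Adj G v u
  adj-sym {u} {v} u~v = ≡-trans (sym G v u) u~v

  ¬adj-refl : ∀ {v} → ¬ Adj G v v
  ¬adj-refl {v} v~v with ≡-trans (≡-sym v~v) (irrefl G v)
  ... | ()

  -- A path or cycle on l vertices is a sequence f : ℕ → Fin n of which only
  -- f 0, …, f (l − 1) matter.
  record IsPath (l : ℕ) (f : ℕ → Fin n) : Set where
    field
      injective : ∀ {a b} → a < l → b < l → f a ≡ f b → a ≡ b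
      adjacent  : ∀ {a} → suc a < l → Adj G (f a) (f (suc a))

  record IsCycle (l : ℕ) (f : ℕ → Fin n) : Set where
    field
      isPath : IsPath l f
      long   : 3 ≤ l
      closed : Adj G (f (pred l)) (f 0)

  record IsInducedPath (l : ℕ) (f : ℕ → Fin n) : Set where
    field
      isPath    : IsPath l f
      chordless : ∀ {a b} → a < l → b < l → Adj G (f a) (f b) → b ≡ suc a ⊎ a ≡ suc b

  open IsPath public
  open IsCycle public
  open IsInducedPath public

  singleton : ∀ x → IsPath 1 (const x)
  singleton x = record
    { injective = λ a<1 b<1 _ → ≡-trans (n<1⇒n≡0 a<1) (≡-sym (n<1⇒n≡0 b<1))
    ; adjacent  = λ { (s≤s ()) } }

  restrict : ∀ {l b f} → IsPath l f → b ≤ l → IsPath b f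
  restrict P b≤l = record
    { injective = λ x<b y<b → injective P (<-≤-trans x<b b≤l) (<-≤-trans y<b b≤l)
    ; adjacent  = λ x<b → adjacent P (<-≤-trans x<b b≤l) }

  segment : ∀ {l b f} a → IsPath l f → b + a ≤ l → IsPath b (λ t → f (t + a))
  segment {b = b} a P b+a≤l = record
    { injective = λ x<b y<b eq → +-cancelʳ-≡ _ _ _ (injective P (shift x<b) (shift y<b) eq)
    ; adjacent  = λ x<b → adjacent P (shift x<b) }
    where
    shift : ∀ {x} → x < b → x + a < _
    shift x<b = <-≤-trans (+-monoˡ-< a x<b) b+a≤l

  append : ∀ {l m d e} → IsPath (suc l) d → IsPath (suc m) e →
           (∀ {a b} → a < suc l → b < suc m → d a ≢ e b) → Adj G (d l) (e 0) →
           IsPath (suc l + suc m) (d ++[ suc l ] e)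
  append {l} {m} {d} {e} P Q disjoint d~e = record { injective = g-injective ; adjacent = g-adjacent }
    where
    g = d ++[ suc l ] e
    back : ∀ {s} → suc l + s < suc l + suc m → s < suc m
    back = +-cancelˡ-< (suc l) _ _
    g-left : ∀ {t} → t < suc l → g t ≡ d t
    g-left = ++-left d e
    g-right : ∀ s → g (suc l + s) ≡ e s
    g-right = ++-right (suc l) d e
    g-injective : ∀ {a b} → a < suc l + suc m → b < suc l + suc m → g a ≡ g b → a ≡ b
    g-injective {a} {b} a< b< eq with split (suc l) a | split (suc l) b
    ... | left a<l | left b<l =
      injective P a<l b<l (≡-trans (≡-sym (g-left a<l)) (≡-trans eq (g-left b<l)))
    ... | left a<l | right s =
      ⊥-elim (disjoint a<l (back b<) (≡-trans (≡-sym (g-left a<l)) (≡-trans eq (g-right s))))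
    ... | right s | left b<l =
      ⊥-elim (disjoint b<l (back a<) (≡-trans (≡-sym (g-left b<l)) (≡-trans (≡-sym eq) (g-right s))))
    ... | right s | right s′ = cong (suc l +_) (injective Q (back a<) (back b<)
      (≡-trans (≡-sym (g-right s)) (≡-trans eq (g-right s′))))
    g-adjacent : ∀ {a} → suc a < suc l + suc m → Adj G (g a) (g (suc a))
    g-adjacent {a} a+1< with split (suc l) a
    ... | right s = subst₂ (Adj G) (≡-sym (g-right s))
      (≡-sym (≡-trans (cong g (≡-sym (+-suc (suc l) s))) (g-right (suc s))))
      (adjacent Q (back (subst (_< suc l + suc m) (≡-sym (+-suc (suc l) s)) a+1<)))
    ... | left a<l with m≤n⇒m<n∨m≡n a<l
    ...   | inj₁ a+1<l = subst₂ (Adj G) (≡-sym (g-left a<l)) (≡-sym (g-left a+1<l)) (adjacent P a+1<l)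
    ...   | inj₂ refl = subst₂ (Adj G) (≡-sym (g-left a<l))
      (≡-sym (≡-trans (cong g (≡-sym (+-identityʳ (suc l)))) (g-right 0))) d~e

  glue : ∀ {l m d e} → IsPath (suc l) d → IsPath (suc m) e →
         (∀ {a b} → a < suc l → b < suc m → d a ≢ e b) →
         Adj G (d l) (e 0) → Adj G (e m) (d 0) → 3 ≤ suc l + suc m →
         IsCycle (suc l + suc m) (d ++[ suc l ] e)
  glue {l} {m} {d} {e} P Q disjoint d~e e~d 3≤ = record
    { isPath = append P Q disjoint d~e
    ; long   = 3≤
    ; closed = subst (λ v → Adj G v (d 0)) (≡-sym last) e~d }
    where
    last : (d ++[ suc l ] e) (l + suc m) ≡ e m
    last = ≡-trans (cong (d ++[ suc l ] e) (+-suc l m)) (++-right (suc l) d e m)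

  rotate : ∀ {l f} → IsCycle l f → ∀ {p} → p < l →
           ∃[ g ] IsCycle l g × g 0 ≡ f p × (∀ t → ∃[ s ] g t ≡ f s)
  rotate {f = f} C {zero} _ = f , C , refl , λ t → t , refl
  rotate {l} {f} C {suc p} p+1<l with split (suc (suc p)) l
  ... | left l<p+2 = ⊥-elim (<⇒≱ p+1<l (≤-pred l<p+2))
  ... | right o = g , subst (λ L → IsCycle L g) length≡ cycle , refl , values
    where
    d : ℕ → Fin n
    d t = f (t + suc p)
    g = d ++[ suc o ] f
    o+p+1≡ : o + suc p ≡ suc (p + o)
    o+p+1≡ = ≡-trans (+-suc o p) (cong suc (+-comm o p))
    length≡ : suc o + suc p ≡ suc (suc p) + o
    length≡ = cong suc o+p+1≡
    disjoint : ∀ {a b} → a < suc o → b < suc p → d a ≢ f b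
    disjoint {a} a<o+1 b<p+1 eq = <⇒≢ (≤-trans b<p+1 (m≤n+m (suc p) a)) (≡-sym
      (injective (isPath C) (<-≤-trans (+-monoˡ-< (suc p) a<o+1) (≤-reflexive length≡)) (<-trans b<p+1 p+1<l) eq))
    cycle : IsCycle (suc o + suc p) g
    cycle = glue (segment (suc p) (isPath C) (≤-reflexive length≡)) (restrict (isPath C) (<⇒≤ p+1<l)) disjoint
      (subst (λ v → Adj G (f v) (f 0)) (≡-sym o+p+1≡) (closed C)) (adjacent (isPath C) p+1<l)
      (subst (3 ≤_) (≡-sym length≡) (long C))
    values : ∀ t → ∃[ s ] g t ≡ f s
    values t with split (suc o) t
    ... | left t<o+1 = t + suc p , ++-left d f t<o+1
    ... | right s    = s , ++-right (suc o) d f s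

  last≢first : ∀ {l g} → IsCycle l g → g (pred l) ≢ g 0
  last≢first {l} C eq = contradiction (subst (2 ≤_) l-1≡0 (pred-mono-≤ (long C))) λ ()
    where
    0<l : 0 < l
    0<l = <-≤-trans z<s (long C)
    l-1≡0 : pred l ≡ 0
    l-1≡0 = injective (isPath C) (m≤pred[n]⇒suc[m]≤n {{>-nonZero 0<l}} ≤-refl) 0<l eq

  fromCycle : ∀ {m} (C : Cycle G m) .{{_ : NonZero m}} → IsCycle m (λ t → vert C (t mod m))
  fromCycle {m} C = record
    { isPath = record
      { injective = λ a<m b<m eq →
          ≡-trans (≡-sym (toℕ-mod a<m)) (≡-trans (cong toℕ (distinct C eq)) (toℕ-mod b<m))
      ; adjacent  = λ {a} a+1<m → edges C _ _ (inj₁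
          (≡-trans (toℕ-mod a+1<m) (cong suc (≡-sym (toℕ-mod (<-trans (n<1+n a) a+1<m)))))) }
    ; long   = atLeast3 C
    ; closed = edges C _ _ (inj₂ (toℕ-mod (>-nonZero⁻¹ m) ,
        ≡-trans (cong suc (toℕ-mod (m≤pred[n]⇒suc[m]≤n ≤-refl))) (suc-pred m))) }

  toCycle : ∀ {l f} → IsCycle l f → Cycle G l
  toCycle {l} {f} C = record
    { atLeast3 = long C
    ; vert     = f ∘ toℕ
    ; distinct = λ {i} {j} eq → toℕ-injective (injective (isPath C) (toℕ<n i) (toℕ<n j) eq)
    ; edges    = edge }
    where
    edge : ∀ i j → CycSucc i j → Adj G (f (toℕ i)) (f (toℕ j))
    edge i j (inj₁ j≡1+i) = subst (Adj G (f (toℕ i)) ∘ f) (≡-sym j≡1+i)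
      (adjacent (isPath C) (subst (_< l) j≡1+i (toℕ<n j)))
    edge i j (inj₂ (j≡0 , 1+i≡l)) = subst₂ (λ a b → Adj G (f a) (f b))
      (≡-sym (cong pred 1+i≡l)) (≡-sym j≡0) (closed C)

  toInducedPath : ∀ {l f} → IsInducedPath l f → InducedPath G l
  toInducedPath {l} {f} P = record
    { pvert     = f ∘ toℕ
    ; pdistinct = λ {i} {j} eq → toℕ-injective (injective (isPath P) (toℕ<n i) (toℕ<n j) eq)
    ; padj      = λ i j → chordless P (toℕ<n i) (toℕ<n j)
    ; pedge     = λ i j j≡1+i → subst (Adj G (f (toℕ i)) ∘ f) (≡-sym j≡1+i)
        (adjacent (isPath P) (subst (_< l) j≡1+i (toℕ<n j))) }

  single-vertex : ∀ u → IsInducedPath 1 (const u)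
  single-vertex u = record
    { isPath    = singleton u
    ; chordless = λ _ _ u~u → ⊥-elim (¬adj-refl u~u) }

  extend : ∀ {j f x} → IsInducedPath (suc j) f → (∀ {a} → a < suc j → x ≢ f a) →
           Adj G (f j) x → (∀ {a} → a < j → ¬ Adj G (f a) x) →
           IsInducedPath (suc (suc j)) (f ++[ suc j ] const x)
  extend {j} {f} {x} P new f~x no-chord = record
    { isPath    = subst (λ l → IsPath l g) (cong suc (+-comm j 1))
        (append (isPath P) (singleton x) (λ a<j+1 _ → new a<j+1 ∘ ≡-sym) f~x)
    ; chordless = g-chordless }
    where
    g = f ++[ suc j ] const x
    g-last : g (suc j) ≡ x
    g-last = ≡-trans (cong g (≡-sym (+-identityʳ (suc j)))) (++-right (suc j) f (const x) 0)
    old-or-last : ∀ {a} → a < suc (suc j) → a < suc j ⊎ a ≡ suc j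
    old-or-last a<j+2 = m≤n⇒m<n∨m≡n (≤-pred a<j+2)
    only-last : ∀ {a} → a < suc j → Adj G (f a) x → a ≡ j
    only-last a<j+1 fa~x with m≤n⇒m<n∨m≡n (≤-pred a<j+1)
    ... | inj₁ a<j = ⊥-elim (no-chord a<j fa~x)
    ... | inj₂ a≡j = a≡j
    g-chordless : ∀ {a b} → a < suc (suc j) → b < suc (suc j) → Adj G (g a) (g b) → b ≡ suc a ⊎ a ≡ suc b
    g-chordless a<j+2 b<j+2 ga~gb with old-or-last a<j+2 | old-or-last b<j+2
    ... | inj₁ a<j+1 | inj₁ b<j+1 =
      chordless P a<j+1 b<j+1 (subst₂ (Adj G) (++-left f _ a<j+1) (++-left f _ b<j+1) ga~gb)
    ... | inj₁ a<j+1 | inj₂ refl =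
      inj₁ (cong suc (≡-sym (only-last a<j+1 (subst₂ (Adj G) (++-left f _ a<j+1) g-last ga~gb))))
    ... | inj₂ refl | inj₁ b<j+1 =
      inj₂ (cong suc (≡-sym (only-last b<j+1 (adj-sym (subst₂ (Adj G) g-last (++-left f _ b<j+1) ga~gb)))))
    ... | inj₂ refl | inj₂ refl = ⊥-elim (¬adj-refl (subst₂ (Adj G) g-last g-last ga~gb))

  longer-cycle : ∀ {j m f g} → IsPath (suc j) f → IsCycle m g → g 0 ≡ f j →
                 (∀ t {a} → a < j → g t ≢ f a) →
                 ∀ {a} → a < j → Adj G (g (pred m)) (f a) → ∃[ l ] m < l × Cycle G l
  longer-cycle {m = zero} _ C = contradiction (long C) λ ()
  longer-cycle {j} {suc m} {f} {g} P C g0≡fj avoids {a} a<j g~fa with split (suc a) j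
  ... | left j<a+1 = ⊥-elim (<⇒≱ a<j (≤-pred j<a+1))
  ... | right q    = suc q + suc m , m<n+m (suc m) z<s , toCycle cycle
    where
    q+a≤a+q : q + a ≤ a + q
    q+a≤a+q = ≤-reflexive (+-comm q a)
    disjoint : ∀ {x y} → x < suc q → y < suc m → f (x + a) ≢ g y
    disjoint {y = y} x<q+1 _ eq =
      avoids y (s≤s (≤-trans (+-monoˡ-≤ a (≤-pred x<q+1)) q+a≤a+q)) (≡-sym eq)
    f~g0 : Adj G (f (q + a)) (g 0)
    f~g0 = subst (Adj G (f (q + a))) (≡-trans (cong (f ∘ suc) (+-comm q a)) (≡-sym g0≡fj))
      (adjacent P (s≤s (s≤s q+a≤a+q)))
    cycle : IsCycle (suc q + suc m) ((λ t → f (t + a)) ++[ suc q ] g)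
    cycle = glue (segment a P (s≤s (≤-trans q+a≤a+q (n≤1+n _)))) (isPath C) disjoint f~g0 g~fa
      (≤-trans (long C) (m≤n+m (suc m) (suc q)))

  endpoint-unvisited : ∀ {j f} → IsPath (suc j) f → f j ∈ unvisited f j
  endpoint-unvisited {j} {f} P = ∈unvisited f j λ a<j fj≡fa →
    <⇒≢ a<j (≡-sym (injective P ≤-refl (m<n⇒m<1+n a<j) fj≡fa))

  spanning-cycle-through : ∀ {m S v} .{{_ : NonZero m}} → ∣ S ∣ ≡ m → InducedHamiltonian G S → v ∈ S →
                           ∃[ g ] IsCycle m g × g 0 ≡ v × (∀ t → g t ∈ S)
  spanning-cycle-through {S = S} refl (C , C⊆S) v∈S
    with injective⇒onto S (distinct C) C⊆S refl v∈S
  ... | i , Ci≡v with rotate (fromCycle C) (toℕ<n i)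
  ... | g , cycle , g0≡ , values =
    g , cycle , ≡-trans g0≡ (≡-trans (cong (vert C) (toℕ-injective (toℕ-mod (toℕ<n i)))) Ci≡v) , g∈S
    where
    g∈S : ∀ t → g t ∈ S
    g∈S t with values t
    ... | s , gt≡ = subst (_∈ S) (≡-sym gt≡) (C⊆S _)

module Growth {n c k} {G : Graph n} (c+k≡n : c + k ≡ n) (maximal : ∀ l → Cycle G l → l ≤ c)
  (hamiltonian : ∀ S → ∣ S ∣ ≡ c → InducedHamiltonian G S) .{{_ : NonZero c}} where

  c≤∣unvisited∣ : ∀ {j} (f : ℕ → Fin n) → j < k → c ≤ ∣ unvisited f j ∣
  c≤∣unvisited∣ {j} f j<k = +-cancelˡ-≤ j c _ (≤-trans (≤-trans (+-monoˡ-≤ c (<⇒≤ j<k))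
    (≤-reflexive (≡-trans (+-comm k c) c+k≡n))) (∣unvisited∣ f j))

  cycle-at-endpoint : ∀ {j f} → IsPath G (suc j) f → j < k →
                 ∃[ g ] IsCycle G c g × g 0 ≡ f j × (∀ t {a} → a < j → g t ≢ f a)
  cycle-at-endpoint {j} {f} P j<k
    with subset-of-size-∋ (unvisited f j) (endpoint-unvisited G P) (>-nonZero⁻¹ c) (c≤∣unvisited∣ f j<k)
  ... | S , S⊆T , fj∈S , ∣S∣≡c with spanning-cycle-through G ∣S∣≡c (hamiltonian S ∣S∣≡c) fj∈S
  ... | g , C , g0≡fj , g∈S = g , C , g0≡fj ,
    λ t a<j gt≡fa → visited∉unvisited f a<j (S⊆T (subst (_∈ S) gt≡fa (g∈S t)))

  next-vertex : ∀ {j f} → IsInducedPath G (suc j) f → j < k →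
    ∃[ x ] (∀ {a} → a < suc j → x ≢ f a) × Adj G (f j) x × (∀ {a} → a < j → ¬ Adj G (f a) x)
  next-vertex {j} {f} P j<k with cycle-at-endpoint (isPath P) j<k
  ... | g , C , g0≡fj , avoids = x , x-new , adj-sym G (subst (Adj G x) g0≡fj (closed C)) , x-no-chord
    where
    x = g (pred c)
    x-new : ∀ {a} → a < suc j → x ≢ f a
    x-new a<j+1 with m≤n⇒m<n∨m≡n (≤-pred a<j+1)
    ... | inj₁ a<j  = avoids (pred c) a<j
    ... | inj₂ refl = λ x≡fj → last≢first G C (≡-trans x≡fj (≡-sym g0≡fj))
    x-no-chord : ∀ {a} → a < j → ¬ Adj G (f a) x
    x-no-chord a<j fa~x with longer-cycle G (isPath P) C g0≡fj avoids a<j (adj-sym G fa~x)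
    ... | l , c<l , C′ = <⇒≱ c<l (maximal l C′)

  grow : ∀ u j → j ≤ k → ∃[ f ] IsInducedPath G (suc j) f × f 0 ≡ u
  grow u zero    _   = const u , single-vertex G u , refl
  grow u (suc j) j<k with grow u j (<⇒≤ j<k)
  ... | f , P , f0≡u with next-vertex P j<k
  ... | x , new , f~x , no-chord = f ++[ suc j ] const x , extend G P new f~x no-chord , f0≡u

circumference>0 : ∀ {n c} {G : Graph n} → (∀ S → ∣ S ∣ ≡ c → InducedHamiltonian G S) → 0 < c
circumference>0 {n} {zero} hamiltonian =
  contradiction (subst (3 ≤_) (∣⊥∣≡0 n) (atLeast3 (proj₁ (hamiltonian ⊥ (∣⊥∣≡0 n))))) λ ()
circumference>0 {c = suc c} _ = z<s

mainTheorem5 : (n k : ℕ) → 1 ≤ k → 2 ≤ k → k ≤ n → (G : Graph n) → InΓ n k G →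
    (u₁ : Fin n) → Σ ℕ (λ m → (suc k ≤ suc m) × Σ (InducedPath G (suc m)) (λ P → pvert P zero ≡ u₁))
mainTheorem5 n k _ _ _ G (c , c+k≡n , (maximal , _) , hamiltonian) u₁
  with Growth.grow c+k≡n maximal hamiltonian {{>-nonZero (circumference>0 hamiltonian)}} u₁ k ≤-refl
... | f , P , f0≡u₁ = k , ≤-refl , toInducedPath G P , f0≡u₁
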